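{- Let $r = r(n)$ be any positive integer with $r \geq 4$ (possibly depending on $n$). Consider the random temporal graph on $n$ nodes in which the underlying graph is the complete directed graph on $n$ nodes (every ordered pair $(u,v)$ of distinct nodes is an arc) and every arc independently receives a single time-label chosen uniformly at random from $[r]=\{1,2,\ldots,r\}$. Then the probability that this random temporal graph contains a journey of length $4$ tends to $1$ as $n \to \infty$.
   Context: A journey of length $k$ in a temporal digraph in which each arc has a single label is a directed path $(u_1,u_2,\ldots,u_{k+1})$ on $k+1$ pairwise distinct nodes whose consecutive arcs $(u_1,u_2),(u_2,u_3),\ldots,(u_k,u_{k+1})$ have strictly increasing labels. "Almost all random temporal graphs have property P" means that the probability of P tends to $1$ as $n\to\infty$. -}

module Defs where

open import Data.Nat using (ℕ; zero; suc; _≤_; _<_; _*_)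
open import Data.Fin using (Fin; _≟_) renaming (_<_ to _<ᶠ_; _<?_ to _<ᶠ?_)
open import Data.Fin.Properties using (any?)
open import Data.Vec using (Vec; []; _∷_; lookup)
open import Data.List using (List; []; _∷_; [_]; map; concatMap; allFin; filter; length)
open import Data.Product using (Σ; ∃; _×_; _,_)
open import Relation.Binary.PropositionalEquality using (_≢_)
open import Relation.Nullary using (Dec; ¬_)
open import Relation.Nullary.Decidable using (_×-dec_; ¬?)

-- A labelled complete digraph on nodes Fin n with labels in Fin r
-- (Fin r = {0,...,r-1} stands for [r] = {1,...,r}; only the order matters).  Diagonal entries are
-- never used (journeys visit pairwise distinct nodes).
Labeling : ℕ → ℕ → Set
Labeling n r = Vec (Vec (Fin r) n) n

lab : ∀ {n r} → Labeling n r → Fin n → Fin n → Fin r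
lab L u v = lookup (lookup L u) v

Distinct5 : ∀ {n} → Fin n → Fin n → Fin n → Fin n → Fin n → Set
Distinct5 a b c d e =
  (a ≢ b) × (a ≢ c) × (a ≢ d) × (a ≢ e) × (b ≢ c) ×
  (b ≢ d) × (b ≢ e) × (c ≢ d) × (c ≢ e) × (d ≢ e)

Journey4 : ∀ {n r} → Labeling n r → Set
Journey4 {n} L =
  Σ (Fin n) λ u1 → Σ (Fin n) λ u2 → Σ (Fin n) λ u3 → Σ (Fin n) λ u4 → Σ (Fin n) λ u5 →
    Distinct5 u1 u2 u3 u4 u5 ×
    (lab L u1 u2 <ᶠ lab L u2 u3) × (lab L u2 u3 <ᶠ lab L u3 u4) × (lab L u3 u4 <ᶠ lab L u4 u5)

journey4? : ∀ {n r} (L : Labeling n r) → Dec (Journey4 L)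
journey4? L =
  any? λ a → any? λ b → any? λ c → any? λ d → any? λ e →
    ((¬? (a ≟ b)) ×-dec (¬? (a ≟ c)) ×-dec (¬? (a ≟ d)) ×-dec (¬? (a ≟ e)) ×-dec
     (¬? (b ≟ c)) ×-dec (¬? (b ≟ d)) ×-dec (¬? (b ≟ e)) ×-dec (¬? (c ≟ d)) ×-dec
     (¬? (c ≟ e)) ×-dec (¬? (d ≟ e)))
    ×-dec (lab L a b <ᶠ? lab L b c) ×-dec (lab L b c <ᶠ? lab L c d) ×-dec (lab L c d <ᶠ? lab L d e)

allVecs : ∀ {A : Set} → List A → (k : ℕ) → List (Vec A k)
allVecs xs zero = [ [] ]
allVecs xs (suc k) = concatMap (λ x → map (x ∷_) (allVecs xs k)) xs

-- all labelings (uniform sample space; each listed exactly once)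
allLabelings : (n r : ℕ) → List (Labeling n r)
allLabelings n r = allVecs (allVecs (allFin r) n) n

total : ℕ → ℕ → ℕ
total n r = length (allLabelings n r)

badCount : ℕ → ℕ → ℕ
badCount n r = length (filter (λ L → ¬? (journey4? L)) (allLabelings n r))

module Submission where

-- Cut the first 4m nodes into m blocks of four consecutive nodes u₀ u₁ u₂ u₃,
-- and let the last node be a common sink. The arcs u₀u₁, u₁u₂, u₂u₃, u₃sink
-- lie in the rows of u₀ … u₃, so different blocks use disjoint rows and are
-- independent. Each block is a journey when the four labels fall into the
-- four consecutive quarters of [r], which happens with probability at least
-- (⌊r/4⌋/r)⁴ ≥ 1/4096. Hence every block fails for at most a (4095/4096)^m
-- fraction of labelings, and Bernoulli's inequality makes this < 1/(k+1)
-- for m = 4095(k+1).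

open import Defs
open import Data.Nat using (ℕ; zero; suc; _+_; _*_; _^_; _≤_; _<_; z≤n; s≤s; _/_; _%_; >-nonZero)
open import Data.Nat.Properties
open import Data.Nat.DivMod using (m≡m%n+[m/n]*n; m%n<n; m/n*n≤m; m≥n⇒m/n>0)
open import Data.Nat.Tactic.RingSolver using (solve-∀)
open import Data.Bool using (Bool; true; false; _∧_; not; T)
open import Data.Unit using (tt)
open import Data.Empty using (⊥-elim)
open import Data.Fin using (Fin; toℕ; fromℕ) renaming (zero to fzero; suc to fsuc; _<_ to _<ᶠ_; _≤_ to _≤ᶠ_; _<?_ to _<ᶠ?_)
import Data.Fin.Properties as Fin
open import Data.Vec using (Vec; []; _∷_; lookup; _++_; foldr′) renaming (map to vmap)
open import Data.List using (List; []; _∷_; map; concatMap; allFin; filter; length) renaming (_++_ to _++ₗ_)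
open import Data.List.Properties using (map-tabulate; length-tabulate)
open import Data.Product using (∃; _×_; _,_; proj₁; proj₂)
open import Function using (_∘_; id)
open import Relation.Binary.PropositionalEquality
open import Relation.Nullary using (Dec; yes; no; ¬_)
open import Relation.Nullary.Decidable using (⌊_⌋; ¬?; _×-dec_; toWitness; fromWitness)

∑ : {A : Set} → List A → (A → ℕ) → ℕ
∑ [] f = 0
∑ (x ∷ xs) f = f x + ∑ xs f

module _ {A : Set} where

  ∑-cong : (xs : List A) {f g : A → ℕ} → (∀ x → f x ≡ g x) → ∑ xs f ≡ ∑ xs g
  ∑-cong [] e = refl
  ∑-cong (x ∷ xs) e = cong₂ _+_ (e x) (∑-cong xs e)

  ∑-mono : (xs : List A) {f g : A → ℕ} → (∀ x → f x ≤ g x) → ∑ xs f ≤ ∑ xs g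
  ∑-mono [] e = z≤n
  ∑-mono (x ∷ xs) e = +-mono-≤ (e x) (∑-mono xs e)

  ∑-+ : (xs : List A) (f g : A → ℕ) → ∑ xs (λ x → f x + g x) ≡ ∑ xs f + ∑ xs g
  ∑-+ [] f g = refl
  ∑-+ (x ∷ xs) f g rewrite ∑-+ xs f g = +-exchange (f x) (g x) (∑ xs f) (∑ xs g)
    where
    +-exchange : ∀ a b c d → a + b + (c + d) ≡ a + c + (b + d)
    +-exchange = solve-∀

  ∑-*ˡ : (xs : List A) (c : ℕ) (f : A → ℕ) → ∑ xs (λ x → c * f x) ≡ c * ∑ xs f
  ∑-*ˡ [] c f = sym (*-zeroʳ c)
  ∑-*ˡ (x ∷ xs) c f = trans (cong (c * f x +_) (∑-*ˡ xs c f)) (sym (*-distribˡ-+ c (f x) _))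

  ∑-*ʳ : (xs : List A) (f : A → ℕ) (c : ℕ) → ∑ xs (λ x → f x * c) ≡ ∑ xs f * c
  ∑-*ʳ xs f c = begin
    ∑ xs (λ x → f x * c) ≡⟨ ∑-cong xs (λ x → *-comm (f x) c) ⟩
    ∑ xs (λ x → c * f x) ≡⟨ ∑-*ˡ xs c f ⟩
    c * ∑ xs f           ≡⟨ *-comm c _ ⟩
    ∑ xs f * c           ∎
    where open ≡-Reasoning

  ∑-const : (xs : List A) (c : ℕ) → ∑ xs (λ _ → c) ≡ length xs * c
  ∑-const [] c = refl
  ∑-const (x ∷ xs) c = cong (c +_) (∑-const xs c)

  ∑-++ : (xs ys : List A) (f : A → ℕ) → ∑ (xs ++ₗ ys) f ≡ ∑ xs f + ∑ ys f
  ∑-++ [] ys f = refl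
  ∑-++ (x ∷ xs) ys f = trans (cong (f x +_) (∑-++ xs ys f)) (sym (+-assoc (f x) _ _))

∑-map : {A B : Set} (g : A → B) (xs : List A) (f : B → ℕ) → ∑ (map g xs) f ≡ ∑ xs (f ∘ g)
∑-map g [] f = refl
∑-map g (x ∷ xs) f = cong (f (g x) +_) (∑-map g xs f)

∑-concatMap : {A B : Set} (g : A → List B) (xs : List A) (f : B → ℕ) →
  ∑ (concatMap g xs) f ≡ ∑ xs (λ x → ∑ (g x) f)
∑-concatMap g [] f = refl
∑-concatMap g (x ∷ xs) f = trans (∑-++ (g x) (concatMap g xs) f) (cong (∑ (g x) f +_) (∑-concatMap g xs f))

module VectorSums {A : Set} (xs : List A) where

  ∑-allVecs-suc : ∀ k (f : Vec A (suc k) → ℕ) →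
    ∑ (allVecs xs (suc k)) f ≡ ∑ xs (λ x → ∑ (allVecs xs k) (λ v → f (x ∷ v)))
  ∑-allVecs-suc k f = trans (∑-concatMap _ xs f) (∑-cong xs (λ x → ∑-map (x ∷_) (allVecs xs k) f))

  ∑-allVecs-1 : ∀ k → ∑ (allVecs xs k) (λ _ → 1) ≡ length xs ^ k
  ∑-allVecs-1 zero = refl
  ∑-allVecs-1 (suc k) = begin
    ∑ (allVecs xs (suc k)) (λ _ → 1)         ≡⟨ ∑-allVecs-suc k _ ⟩
    ∑ xs (λ _ → ∑ (allVecs xs k) (λ _ → 1))  ≡⟨ ∑-cong xs (λ _ → ∑-allVecs-1 k) ⟩
    ∑ xs (λ _ → length xs ^ k)               ≡⟨ ∑-const xs _ ⟩
    length xs ^ suc k                        ∎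
    where open ≡-Reasoning

  length-allVecs : ∀ k → length (allVecs xs k) ≡ length xs ^ k
  length-allVecs k = trans (sym (trans (∑-const (allVecs xs k) 1) (*-identityʳ _))) (∑-allVecs-1 k)

  ∑-allVecs-++ : ∀ j k (h : Vec A (j + k) → ℕ) →
    ∑ (allVecs xs (j + k)) h ≡ ∑ (allVecs xs j) (λ u → ∑ (allVecs xs k) (λ w → h (u ++ w)))
  ∑-allVecs-++ zero k h = sym (+-identityʳ _)
  ∑-allVecs-++ (suc j) k h = begin
    ∑ (allVecs xs (suc j + k)) h
      ≡⟨ ∑-allVecs-suc (j + k) h ⟩
    ∑ xs (λ x → ∑ (allVecs xs (j + k)) (λ v → h (x ∷ v)))
      ≡⟨ ∑-cong xs (λ x → ∑-allVecs-++ j k (λ v → h (x ∷ v))) ⟩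
    ∑ xs (λ x → ∑ (allVecs xs j) (λ u → ∑ (allVecs xs k) (λ w → h (x ∷ u ++ w))))
      ≡⟨ sym (∑-allVecs-suc j _) ⟩
    ∑ (allVecs xs (suc j)) (λ u → ∑ (allVecs xs k) (λ w → h (u ++ w)))
      ∎
    where open ≡-Reasoning

  productOf : ∀ {k} → Vec (A → ℕ) k → Vec A k → ℕ
  productOf [] [] = 1
  productOf (f ∷ fs) (x ∷ v) = f x * productOf fs v

  ∑-productOf : ∀ {k} (fs : Vec (A → ℕ) k) →
    ∑ (allVecs xs k) (productOf fs) ≡ foldr′ _*_ 1 (vmap (∑ xs) fs)
  ∑-productOf [] = refl
  ∑-productOf {suc k} (f ∷ fs) = begin
    ∑ (allVecs xs (suc k)) (productOf (f ∷ fs))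
      ≡⟨ ∑-allVecs-suc k _ ⟩
    ∑ xs (λ x → ∑ (allVecs xs k) (λ v → f x * productOf fs v))
      ≡⟨ ∑-cong xs (λ x → ∑-*ˡ (allVecs xs k) (f x) (productOf fs)) ⟩
    ∑ xs (λ x → f x * ∑ (allVecs xs k) (productOf fs))
      ≡⟨ ∑-*ʳ xs f _ ⟩
    ∑ xs f * ∑ (allVecs xs k) (productOf fs)
      ≡⟨ cong (∑ xs f *_) (∑-productOf fs) ⟩
    ∑ xs f * foldr′ _*_ 1 (vmap (∑ xs) fs)
      ∎
    where open ≡-Reasoning

  ∑-marginal : ∀ k (x : Fin (suc k)) (p : A → ℕ) →
    ∑ (allVecs xs (suc k)) (λ v → p (lookup v x)) ≡ ∑ xs p * length xs ^ k
  ∑-marginal k fzero p = begin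
    ∑ (allVecs xs (suc k)) (λ v → p (lookup v fzero))  ≡⟨ ∑-allVecs-suc k _ ⟩
    ∑ xs (λ y → ∑ (allVecs xs k) (λ _ → p y))         ≡⟨ ∑-cong xs (λ y → ∑-const (allVecs xs k) (p y)) ⟩
    ∑ xs (λ y → length (allVecs xs k) * p y)          ≡⟨ ∑-*ˡ xs (length (allVecs xs k)) p ⟩
    length (allVecs xs k) * ∑ xs p                    ≡⟨ cong (_* ∑ xs p) (length-allVecs k) ⟩
    length xs ^ k * ∑ xs p                            ≡⟨ *-comm _ (∑ xs p) ⟩
    ∑ xs p * length xs ^ k                            ∎
    where open ≡-Reasoning
  ∑-marginal (suc k) (fsuc x) p = begin
    ∑ (allVecs xs (suc (suc k))) (λ v → p (lookup v (fsuc x)))  ≡⟨ ∑-allVecs-suc (suc k) _ ⟩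
    ∑ xs (λ _ → ∑ (allVecs xs (suc k)) (λ v → p (lookup v x)))  ≡⟨ ∑-cong xs (λ _ → ∑-marginal k x p) ⟩
    ∑ xs (λ _ → ∑ xs p * length xs ^ k)                         ≡⟨ ∑-const xs _ ⟩
    length xs * (∑ xs p * length xs ^ k)                        ≡⟨ *-left-comm (length xs) (∑ xs p) _ ⟩
    ∑ xs p * length xs ^ suc k                                  ∎
    where
    open ≡-Reasoning
    *-left-comm : ∀ a b c → a * (b * c) ≡ b * (a * c)
    *-left-comm = solve-∀

𝟙 : Bool → ℕ
𝟙 true = 1
𝟙 false = 0

𝟙-∧ : ∀ a b → 𝟙 (a ∧ b) ≡ 𝟙 a * 𝟙 b
𝟙-∧ true b = sym (+-identityʳ (𝟙 b))
𝟙-∧ false b = refl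

𝟙-not : ∀ a → 𝟙 (not a) + 𝟙 a ≡ 1
𝟙-not true = refl
𝟙-not false = refl

𝟙-product≤ : ∀ b₀ b₁ b₂ b₃ c → (T b₀ → T b₁ → T b₂ → T b₃ → T c) →
  𝟙 b₀ * (𝟙 b₁ * (𝟙 b₂ * (𝟙 b₃ * 1))) ≤ 𝟙 c
𝟙-product≤ true true true true true _ = ≤-refl
𝟙-product≤ true true true true false h = ⊥-elim (h tt tt tt tt)
𝟙-product≤ false _ _ _ _ _ = z≤n
𝟙-product≤ true false _ _ _ _ = z≤n
𝟙-product≤ true true false _ _ _ = z≤n
𝟙-product≤ true true true false _ _ = z≤n

filter-count : {A : Set} {Q : A → Set} (Q? : ∀ x → Dec (Q x)) (b : A → Bool) →
  (∀ x → Q x → T (b x)) → ∀ xs → length (filter Q? xs) ≤ ∑ xs (𝟙 ∘ b)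
filter-count Q? b h [] = z≤n
filter-count Q? b h (x ∷ xs) with Q? x | b x | h x
... | yes q | true  | _ = s≤s (filter-count Q? b h xs)
... | yes q | false | h′ = ⊥-elim (h′ q)
... | no _  | _     | _ = ≤-trans (filter-count Q? b h xs) (m≤n+m _ _)

inWindow : ℕ → ℕ → ℕ → Bool
inWindow (suc lo) d zero = false
inWindow (suc lo) d (suc t) = inWindow lo d t
inWindow zero zero t = false
inWindow zero (suc d) zero = true
inWindow zero (suc d) (suc t) = inWindow zero d t

inWindow-sound : ∀ lo d t → T (inWindow lo d t) → lo ≤ t × t < lo + d
inWindow-sound (suc lo) d (suc t) h with inWindow-sound lo d t h
... | lo≤t , t<lo+d = s≤s lo≤t , s≤s t<lo+d
inWindow-sound zero (suc d) zero h = z≤n , s≤s z≤n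
inWindow-sound zero (suc d) (suc t) h = z≤n , s≤s (proj₂ (inWindow-sound zero d t h))

∑-allFin-suc : ∀ r (f : Fin (suc r) → ℕ) → ∑ (allFin (suc r)) f ≡ f fzero + ∑ (allFin r) (f ∘ fsuc)
∑-allFin-suc r f = cong (f fzero +_)
  (trans (cong (λ ys → ∑ ys f) (sym (map-tabulate id fsuc))) (∑-map fsuc (allFin r) f))

window-count : ∀ lo d r → lo + d ≤ r → d ≤ ∑ (allFin r) (λ y → 𝟙 (inWindow lo d (toℕ y)))
window-count zero zero r _ = z≤n
window-count zero (suc d) (suc r) (s≤s p) = ≤-trans (s≤s (window-count zero d r p))
  (≤-reflexive (sym (∑-allFin-suc r (λ y → 𝟙 (inWindow zero (suc d) (toℕ y))))))
window-count (suc lo) d (suc r) (s≤s p) = ≤-trans (window-count lo d r p)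
  (≤-reflexive (sym (∑-allFin-suc r (λ y → 𝟙 (inWindow (suc lo) d (toℕ y))))))

-- Bernoulli's inequality (1 + 1/a)^m ≥ 1 + m/a, cleared of denominators.
bernoulli : ∀ a m → a ^ m * (a + m) ≤ suc a ^ m * a
bernoulli a zero = ≤-reflexive (cong (_+ 0) (+-identityʳ a))
bernoulli a (suc m) = begin
    a * a ^ m * (a + suc m)                 ≤⟨ m≤m+n _ _ ⟩
    a * a ^ m * (a + suc m) + a ^ m * m     ≡⟨ expand a (a ^ m) m ⟩
    suc a * (a ^ m * (a + m))               ≤⟨ *-monoʳ-≤ (suc a) (bernoulli a m) ⟩
    suc a * (suc a ^ m * a)                 ≡⟨ *-assoc (suc a) (suc a ^ m) a ⟨
    suc a * suc a ^ m * a                   ∎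
  where
  open ≤-Reasoning
  expand : ∀ a P m → a * P * (a + (1 + m)) + P * m ≡ (1 + a) * (P * (a + m))
  expand = solve-∀

-- Exponential decay beats linear growth: with ratio (1+a)/(2+a) and
-- m = (1+a)(1+k) blocks, (1+k)·(1+a)^m < (2+a)^m.
decay-beats-linear : ∀ a k → suc k * suc a ^ (suc a * suc k) < suc (suc a) ^ (suc a * suc k)
decay-beats-linear a k = begin-strict
    suc k * P      <⟨ +-monoˡ-< (suc k * P) (m^n>0 (suc a) m) ⟩
    P + suc k * P  ≡⟨ *-comm (suc (suc k)) P ⟩
    P * suc (suc k) ≤⟨ *-cancelˡ-≤ (suc a) scaled ⟩
    suc (suc a) ^ m ∎
  where
  open ≤-Reasoning
  m P : ℕ
  m = suc a * suc k
  P = suc a ^ m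
  regroup : ∀ a P k → (1 + a) * (P * (2 + k)) ≡ P * ((1 + a) + (1 + a) * (1 + k))
  regroup = solve-∀
  scaled : suc a * (P * suc (suc k)) ≤ suc a * suc (suc a) ^ m
  scaled = begin
    suc a * (P * suc (suc k)) ≡⟨ regroup a P k ⟩
    P * (suc a + m)           ≤⟨ bernoulli (suc a) m ⟩
    suc (suc a) ^ m * suc a   ≡⟨ *-comm _ (suc a) ⟩
    suc a * suc (suc a) ^ m   ∎

complement-bound : ∀ a F G X → F + G ≡ X → X ≤ suc a * G → suc a * F ≤ a * X
complement-bound a F G X F+G≡X X≤ = +-cancelʳ-≤ (suc a * G) (suc a * F) (a * X) (begin
    suc a * F + suc a * G ≡⟨ *-distribˡ-+ (suc a) F G ⟨
    suc a * (F + G)       ≡⟨ cong (suc a *_) F+G≡X ⟩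
    X + a * X             ≡⟨ +-comm X (a * X) ⟩
    a * X + X             ≤⟨ +-monoʳ-≤ (a * X) X≤ ⟩
    a * X + suc a * G     ∎)
  where open ≤-Reasoning

quarter-fits : ∀ R → 4 * (R / 4) ≤ R
quarter-fits R = ≤-trans (≤-reflexive (*-comm 4 (R / 4))) (m/n*n≤m R 4)

quarter-large : ∀ R → 4 ≤ R → R ≤ 8 * (R / 4)
quarter-large R 4≤R = begin
    R                       ≡⟨ m≡m%n+[m/n]*n R 4 ⟩
    R % 4 + R / 4 * 4       ≤⟨ +-monoˡ-≤ (R / 4 * 4) (<⇒≤ (m%n<n R 4)) ⟩
    4 + R / 4 * 4           ≤⟨ +-monoˡ-≤ (R / 4 * 4) (*-monoʳ-≤ 4 (m≥n⇒m/n>0 4≤R)) ⟩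
    4 * (R / 4) + R / 4 * 4 ≡⟨ eight (R / 4) ⟩
    8 * (R / 4)             ∎
  where
  open ≤-Reasoning
  eight : ∀ q → 4 * q + q * 4 ≡ 8 * q
  eight = solve-∀

scale-down : ∀ s B X P Q → Q * B ≤ P * X → s * P < Q → 0 < X → s * B < X
scale-down s B X P Q QB≤PX sP<Q X>0 = *-cancelˡ-< Q (s * B) X (begin-strict
    Q * (s * B) ≡⟨ *-left-comm Q s B ⟩
    s * (Q * B) ≤⟨ *-monoʳ-≤ s QB≤PX ⟩
    s * (P * X) ≡⟨ *-assoc s P X ⟨
    s * P * X   <⟨ *-monoˡ-< X {{>-nonZero X>0}} sP<Q ⟩
    Q * X       ∎)
  where
  open ≤-Reasoning
  *-left-comm : ∀ a b c → a * (b * c) ≡ b * (a * c)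
  *-left-comm = solve-∀

Increasing : ∀ {r} → Fin r → Fin r → Fin r → Fin r → Set
Increasing y₀ y₁ y₂ y₃ = y₀ <ᶠ y₁ × y₁ <ᶠ y₂ × y₂ <ᶠ y₃

increasing? : ∀ {r} (y₀ y₁ y₂ y₃ : Fin r) → Dec (Increasing y₀ y₁ y₂ y₃)
increasing? y₀ y₁ y₂ y₃ = (y₀ <ᶠ? y₁) ×-dec (y₁ <ᶠ? y₂) ×-dec (y₂ <ᶠ? y₃)

-- Rows a b c d of nodes u₀ … u₃ form a good block for the columns u₁ … u₄ when
-- the arcs u₀u₁, u₁u₂, u₂u₃, u₃u₄ carry increasing labels.
blockGood : ∀ {N r} (u₁ u₂ u₃ u₄ : Fin N) → Vec (Vec (Fin r) N) 4 → Bool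
blockGood u₁ u₂ u₃ u₄ (a ∷ b ∷ c ∷ d ∷ []) =
  ⌊ increasing? (lookup a u₁) (lookup b u₂) (lookup c u₃) (lookup d u₄) ⌋

increasing⇒distinct : ∀ {N} {u₀ u₁ u₂ u₃ u₄ : Fin N} →
  u₀ <ᶠ u₁ → u₁ <ᶠ u₂ → u₂ <ᶠ u₃ → u₃ <ᶠ u₄ → Distinct5 u₀ u₁ u₂ u₃ u₄
increasing⇒distinct {u₀ = u₀} {u₁} {u₂} {u₃} p₀₁ p₁₂ p₂₃ p₃₄ =
  Fin.<⇒≢ p₀₁ , Fin.<⇒≢ p₀₂ , Fin.<⇒≢ p₀₃ , Fin.<⇒≢ (Fin.<-trans p₀₃ p₃₄) ,
  Fin.<⇒≢ p₁₂ , Fin.<⇒≢ p₁₃ , Fin.<⇒≢ (Fin.<-trans p₁₃ p₃₄) ,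
  Fin.<⇒≢ p₂₃ , Fin.<⇒≢ (Fin.<-trans p₂₃ p₃₄) , Fin.<⇒≢ p₃₄
  where
  p₀₂ : u₀ <ᶠ u₂
  p₀₂ = Fin.<-trans p₀₁ p₁₂
  p₁₃ : u₁ <ᶠ u₃
  p₁₃ = Fin.<-trans p₁₂ p₂₃
  p₀₃ : u₀ <ᶠ u₃
  p₀₃ = Fin.<-trans p₀₂ p₂₃

goodBlock⇒journey : ∀ {N r} (L : Labeling N r) {u₀ u₁ u₂ u₃ u₄ : Fin N} {a b c d : Vec (Fin r) N} →
  u₀ <ᶠ u₁ → u₁ <ᶠ u₂ → u₂ <ᶠ u₃ → u₃ <ᶠ u₄ →
  a ≡ lookup L u₀ → b ≡ lookup L u₁ → c ≡ lookup L u₂ → d ≡ lookup L u₃ →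
  T (blockGood u₁ u₂ u₃ u₄ (a ∷ b ∷ c ∷ d ∷ [])) → Journey4 L
goodBlock⇒journey L {u₀} {u₁} {u₂} {u₃} {u₄} p₀₁ p₁₂ p₂₃ p₃₄ refl refl refl refl good =
  u₀ , u₁ , u₂ , u₃ , u₄ , increasing⇒distinct p₀₁ p₁₂ p₂₃ p₃₄ , toWitness good

shift4 : ∀ {k} → Fin k → Fin (4 + k)
shift4 = fsuc ∘ fsuc ∘ fsuc ∘ fsuc

firstBlockFails : ∀ {N r k} → Fin N → (Fin (4 + k) → Fin N) → Vec (Vec (Fin r) N) 4 → Bool
firstBlockFails sink emb u =
  not (blockGood (emb (fsuc fzero)) (emb (fsuc (fsuc fzero))) (emb (fsuc (fsuc (fsuc fzero)))) sink u)

-- allFail sink emb m v: in the vector v of rows, row j being the row of node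
-- emb j, each of the first m consecutive blocks of four rows fails.
allFail : ∀ {N r k} → Fin N → (Fin k → Fin N) → ℕ → Vec (Vec (Fin r) N) k → Bool
allFail sink emb zero v = true
allFail sink emb (suc m) (a ∷ b ∷ c ∷ d ∷ v) =
  firstBlockFails sink emb (a ∷ b ∷ c ∷ d ∷ []) ∧ allFail sink (emb ∘ shift4) m v
allFail sink emb (suc m) _ = true

noJourney⇒allFail : ∀ {N r} (L : Labeling N r) (sink : Fin N) {k} (emb : Fin k → Fin N) m
  (v : Vec (Vec (Fin r) N) k) → ¬ Journey4 L →
  (∀ j → lookup v j ≡ lookup L (emb j)) → (∀ {i j} → i <ᶠ j → emb i <ᶠ emb j) →
  (∀ j → emb j ≤ᶠ sink) → m * 4 < k → T (allFail sink emb m v)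
noJourney⇒allFail L sink emb zero v noJ rowsOf mono belowSink bound = tt
noJourney⇒allFail L sink emb (suc m) (a ∷ b ∷ c ∷ d ∷ v) noJ rowsOf mono belowSink
  (s≤s (s≤s (s≤s (s≤s bound@(s≤s _)))))
  with blockGood (emb (fsuc fzero)) (emb (fsuc (fsuc fzero))) (emb (fsuc (fsuc (fsuc fzero)))) sink
                 (a ∷ b ∷ c ∷ d ∷ []) in good
... | true = ⊥-elim (noJ (goodBlock⇒journey L
    (mono (s≤s z≤n)) (mono (s≤s (s≤s z≤n))) (mono (s≤s (s≤s (s≤s z≤n))))
    (<-≤-trans (mono (s≤s (s≤s (s≤s (s≤s z≤n))))) (belowSink (shift4 fzero)))
    (rowsOf fzero) (rowsOf (fsuc fzero)) (rowsOf (fsuc (fsuc fzero))) (rowsOf (fsuc (fsuc (fsuc fzero))))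
    (subst T (sym good) tt)))
... | false = noJourney⇒allFail L sink (emb ∘ shift4) m v noJ (rowsOf ∘ shift4)
                (λ i<j → mono (s≤s (s≤s (s≤s (s≤s i<j))))) (belowSink ∘ shift4) bound

-- Counting labelings of the complete digraph on suc n' nodes with labels in
-- Fin r, where q is a quarter of r up to a factor two.
module Counting (n' r q : ℕ) (4q≤r : 4 * q ≤ r) (r≤8q : r ≤ 8 * q) where

  Row : Set
  Row = Vec (Fin r) (suc n')

  rows : List Row
  rows = allVecs (allFin r) (suc n')

  rowCount : ℕ
  rowCount = length rows

  module Entries = VectorSums (allFin r)
  open VectorSums rows

  labelCount : length (allFin r) ≡ r
  labelCount = length-tabulate {n = r} id

  rowCount≡ : rowCount ≡ r * r ^ n'
  rowCount≡ = trans (Entries.length-allVecs (suc n')) (cong (_^ suc n') labelCount)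

  band : ℕ → Fin r → Bool
  band i y = inWindow (i * q) q (toℕ y)

  band-fits : ∀ i → i < 4 → i * q + q ≤ r
  band-fits i i<4 = begin
    i * q + q  ≡⟨ +-comm (i * q) q ⟩
    suc i * q  ≤⟨ *-monoˡ-≤ q i<4 ⟩
    4 * q      ≤⟨ 4q≤r ⟩
    r          ∎
    where open ≤-Reasoning

  band-size : ∀ i → i < 4 → (x : Fin (suc n')) → q * r ^ n' ≤ ∑ rows (λ R → 𝟙 (band i (lookup R x)))
  band-size i i<4 x = begin
    q * r ^ n'                                        ≤⟨ *-monoˡ-≤ (r ^ n') (window-count (i * q) q r (band-fits i i<4)) ⟩
    ∑ (allFin r) (𝟙 ∘ band i) * r ^ n'                ≡⟨ cong (λ s → ∑ (allFin r) (𝟙 ∘ band i) * s ^ n') labelCount ⟨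
    ∑ (allFin r) (𝟙 ∘ band i) * length (allFin r) ^ n' ≡⟨ Entries.∑-marginal n' x (𝟙 ∘ band i) ⟨
    ∑ rows (λ R → 𝟙 (band i (lookup R x)))            ∎
    where open ≤-Reasoning

  bands-ordered : ∀ i {y z : Fin r} → T (band i y) → T (band (suc i) z) → y <ᶠ z
  bands-ordered i {y} {z} y∈i z∈i+1 = <-≤-trans
    (subst (toℕ y <_) (+-comm (i * q) q) (proj₂ (inWindow-sound (i * q) q (toℕ y) y∈i)))
    (proj₁ (inWindow-sound (suc i * q) q (toℕ z) z∈i+1))

  bandWeights : (x₁ x₂ x₃ x₄ : Fin (suc n')) → Vec (Row → ℕ) 4
  bandWeights x₁ x₂ x₃ x₄ = inBandAt 0 x₁ ∷ inBandAt 1 x₂ ∷ inBandAt 2 x₃ ∷ inBandAt 3 x₄ ∷ []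
    where
    inBandAt : ℕ → Fin (suc n') → Row → ℕ
    inBandAt i x R = 𝟙 (band i (lookup R x))

  bandWeights≤good : ∀ x₁ x₂ x₃ x₄ (u : Vec Row 4) →
    productOf (bandWeights x₁ x₂ x₃ x₄) u ≤ 𝟙 (blockGood x₁ x₂ x₃ x₄ u)
  bandWeights≤good x₁ x₂ x₃ x₄ (a ∷ b ∷ c ∷ d ∷ []) = 𝟙-product≤ _ _ _ _ _
    (λ h₀ h₁ h₂ h₃ → fromWitness (bands-ordered 0 h₀ h₁ , bands-ordered 1 h₁ h₂ , bands-ordered 2 h₂ h₃))

  good-blocks : ∀ x₁ x₂ x₃ x₄ → rowCount ^ 4 ≤ 4096 * ∑ (allVecs rows 4) (𝟙 ∘ blockGood x₁ x₂ x₃ x₄)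
  good-blocks x₁ x₂ x₃ x₄ = begin
    rowCount ^ 4                     ≤⟨ ^-monoˡ-≤ 4 (≤-trans (≤-reflexive rowCount≡) (*-monoˡ-≤ (r ^ n') r≤8q)) ⟩
    (8 * q * r ^ n') ^ 4             ≡⟨ power q (r ^ n') ⟩
    4096 * (q * r ^ n') ^ 4          ≤⟨ *-monoʳ-≤ 4096 (*-mono-≤ (band-size 0 (s≤s z≤n) x₁)
                                         (*-mono-≤ (band-size 1 (s≤s (s≤s z≤n)) x₂)
                                         (*-mono-≤ (band-size 2 (s≤s (s≤s (s≤s z≤n))) x₃)
                                         (*-monoˡ-≤ 1 (band-size 3 ≤-refl x₄))))) ⟩
    4096 * foldr′ _*_ 1 (vmap (∑ rows) (bandWeights x₁ x₂ x₃ x₄))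
                                     ≡⟨ cong (4096 *_) (∑-productOf (bandWeights x₁ x₂ x₃ x₄)) ⟨
    4096 * ∑ (allVecs rows 4) (productOf (bandWeights x₁ x₂ x₃ x₄))
                                     ≤⟨ *-monoʳ-≤ 4096 (∑-mono (allVecs rows 4) (bandWeights≤good x₁ x₂ x₃ x₄)) ⟩
    4096 * ∑ (allVecs rows 4) (𝟙 ∘ blockGood x₁ x₂ x₃ x₄) ∎
    where
    open ≤-Reasoning
    power : ∀ q c → let y = 8 * q * c ; z = q * c in
            y * (y * (y * (y * 1))) ≡ 4096 * (z * (z * (z * (z * 1))))
    power = solve-∀

  block-fails-rarely : ∀ x₁ x₂ x₃ x₄ →
    4096 * ∑ (allVecs rows 4) (λ u → 𝟙 (not (blockGood x₁ x₂ x₃ x₄ u))) ≤ 4095 * rowCount ^ 4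
  block-fails-rarely x₁ x₂ x₃ x₄ =
    complement-bound 4095 (∑ (allVecs rows 4) (λ u → 𝟙 (not (good u)))) (∑ (allVecs rows 4) (𝟙 ∘ good))
                     (rowCount ^ 4) partition (good-blocks x₁ x₂ x₃ x₄)
    where
    good : Vec Row 4 → Bool
    good = blockGood x₁ x₂ x₃ x₄
    partition : ∑ (allVecs rows 4) (λ u → 𝟙 (not (good u))) + ∑ (allVecs rows 4) (𝟙 ∘ good) ≡ rowCount ^ 4
    partition = trans (sym (∑-+ (allVecs rows 4) (λ u → 𝟙 (not (good u))) (𝟙 ∘ good)))
                      (trans (∑-cong (allVecs rows 4) (λ u → 𝟙-not (good u))) (∑-allVecs-1 4))

  -- Distinct blocks use distinct rows, so failures of the first block and of
  -- the remaining ones are independent.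
  allFail-split : ∀ (sink : Fin (suc n')) {k} (emb : Fin (4 + k) → Fin (suc n')) m →
    ∑ (allVecs rows (4 + k)) (𝟙 ∘ allFail sink emb (suc m))
    ≡ ∑ (allVecs rows 4) (𝟙 ∘ firstBlockFails sink emb) * ∑ (allVecs rows k) (𝟙 ∘ allFail sink (emb ∘ shift4) m)
  allFail-split sink {k} emb m = begin
    ∑ (allVecs rows (4 + k)) (𝟙 ∘ allFail sink emb (suc m))
      ≡⟨ ∑-allVecs-++ 4 k _ ⟩
    ∑ (allVecs rows 4) (λ u → ∑ (allVecs rows k) (λ w → 𝟙 (allFail sink emb (suc m) (u ++ w))))
      ≡⟨ ∑-cong (allVecs rows 4) (λ u → trans (∑-cong (allVecs rows k) (λ w →
           trans (cong 𝟙 (allFail-++ u w)) (𝟙-∧ (fails u) (rest w))))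
                                              (∑-*ˡ (allVecs rows k) (𝟙 (fails u)) (𝟙 ∘ rest))) ⟩
    ∑ (allVecs rows 4) (λ u → 𝟙 (fails u) * ∑ (allVecs rows k) (𝟙 ∘ rest))
      ≡⟨ ∑-*ʳ (allVecs rows 4) (𝟙 ∘ fails) _ ⟩
    ∑ (allVecs rows 4) (𝟙 ∘ fails) * ∑ (allVecs rows k) (𝟙 ∘ rest)
      ∎
    where
    open ≡-Reasoning
    fails : Vec Row 4 → Bool
    fails = firstBlockFails sink emb
    rest : Vec Row k → Bool
    rest = allFail sink (emb ∘ shift4) m
    allFail-++ : ∀ u w → allFail sink emb (suc m) (u ++ w) ≡ fails u ∧ rest w
    allFail-++ (a ∷ b ∷ c ∷ d ∷ []) w = refl

  allFail-count : ∀ (sink : Fin (suc n')) {k} (emb : Fin k → Fin (suc n')) m → m * 4 ≤ k →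
    4096 ^ m * ∑ (allVecs rows k) (𝟙 ∘ allFail sink emb m) ≤ 4095 ^ m * rowCount ^ k
  allFail-count sink {k} emb zero _ = ≤-reflexive (cong (1 *_) (∑-allVecs-1 k))
  allFail-count sink {suc (suc (suc (suc k)))} emb (suc m) (s≤s (s≤s (s≤s (s≤s m*4≤k)))) = begin
    4096 ^ suc m * ∑ (allVecs rows (4 + k)) (𝟙 ∘ allFail sink emb (suc m))
      ≡⟨ cong (4096 ^ suc m *_) (allFail-split sink emb m) ⟩
    4096 ^ suc m * (F * C)          ≡⟨ *-interchange 4096 (4096 ^ m) F C ⟩
    (4096 * F) * (4096 ^ m * C)     ≤⟨ *-mono-≤ (block-fails-rarely _ _ _ sink) (allFail-count sink (emb ∘ shift4) m m*4≤k) ⟩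
    (4095 * rowCount ^ 4) * (4095 ^ m * rowCount ^ k)
                                    ≡⟨ *-interchange 4095 (rowCount ^ 4) (4095 ^ m) (rowCount ^ k) ⟩
    4095 ^ suc m * (rowCount ^ 4 * rowCount ^ k)
                                    ≡⟨ cong (4095 ^ suc m *_) (^-distribˡ-+-* rowCount 4 k) ⟨
    4095 ^ suc m * rowCount ^ (4 + k) ∎
    where
    open ≤-Reasoning
    F C : ℕ
    F = ∑ (allVecs rows 4) (𝟙 ∘ firstBlockFails sink emb)
    C = ∑ (allVecs rows k) (𝟙 ∘ allFail sink (emb ∘ shift4) m)
    *-interchange : ∀ a b c d → a * b * (c * d) ≡ (a * c) * (b * d)
    *-interchange = solve-∀

few-bad-labelings : ∀ n' R m → 4 ≤ R → m * 4 ≤ n' →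
  4096 ^ m * badCount (suc n') R ≤ 4095 ^ m * total (suc n') R
few-bad-labelings n' R m 4≤R m*4≤n' = begin
  4096 ^ m * badCount (suc n') R
    ≤⟨ *-monoʳ-≤ (4096 ^ m) (filter-count (λ L → ¬? (journey4? L)) (allFail sink id m)
         (λ L noJ → noJourney⇒allFail L sink id m L noJ (λ _ → refl) id Fin.≤fromℕ (s≤s m*4≤n'))
         (allLabelings (suc n') R)) ⟩
  4096 ^ m * ∑ (allLabelings (suc n') R) (𝟙 ∘ allFail sink id m)
    ≤⟨ allFail-count sink id m (m≤n⇒m≤1+n m*4≤n') ⟩
  4095 ^ m * rowCount ^ suc n'
    ≡⟨ cong (4095 ^ m *_) (length-allVecs (suc n')) ⟨
  4095 ^ m * total (suc n') R ∎
  where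
  open ≤-Reasoning
  open Counting n' R (R / 4) (quarter-fits R) (quarter-large R 4≤R)
  open VectorSums rows
  sink : Fin (suc n')
  sink = fromℕ n'

total-positive : ∀ n R → 0 < R → 0 < total n R
total-positive n (suc R) _ = begin-strict
  0                          <⟨ m^n>0 (suc R ^ n) {{m^n≢0 (suc R) n}} n ⟩
  (suc R ^ n) ^ n            ≡⟨ cong (_^ n) rowsLength ⟨
  length rows ^ n            ≡⟨ VectorSums.length-allVecs rows n ⟨
  total n (suc R)            ∎
  where
  open ≤-Reasoning
  rows : List (Vec (Fin (suc R)) n)
  rows = allVecs (allFin (suc R)) n
  rowsLength : length rows ≡ suc R ^ n
  rowsLength = trans (VectorSums.length-allVecs (allFin (suc R)) n) (cong (_^ n) (length-tabulate {n = suc R} id))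

mainTheorem1 : (r : ℕ → ℕ) → (∀ n → 4 ≤ r n) →
    ∀ (k : ℕ) → ∃ λ (N : ℕ) → ∀ (n : ℕ) → N ≤ n →
      suc k * badCount n (r n) < total n (r n)
mainTheorem1 r 4≤r k = suc (m * 4) , large
  where
  m : ℕ
  m = 4095 * suc k
  large : ∀ n → suc (m * 4) ≤ n → suc k * badCount n (r n) < total n (r n)
  large (suc n') (s≤s m*4≤n') =
    scale-down (suc k) (badCount (suc n') (r (suc n'))) (total (suc n') (r (suc n'))) (4095 ^ m) (4096 ^ m)
      (few-bad-labelings n' (r (suc n')) m (4≤r (suc n')) m*4≤n')
      (decay-beats-linear 4094 k)
      (total-positive (suc n') (r (suc n')) (<-≤-trans (s≤s z≤n) (4≤r (suc n'))))
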